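{- Let $h\geq 1$ and $n\geq 1$ be integers and let $\mathbf{t}=(t_1,\dots,t_n)$ be an $h$-depth neighborhood, i.e. an $n$-tuple of unlabeled rooted trees each of depth at most $h$. Then $\mathbf{t}$ is graphical if and only if both of the following hold: (i) for every type $\tau\in\Delta$, the integer sequence $(d^\tau_i)_{i\in[n]}$ is graphical, i.e. there is a simple graph on vertex set $[n]$ in which vertex $i$ has degree $d^\tau_i$ for all $i$; (ii) for every $\tau\in A$, the double sequence $(d^\tau_i,d^{\tau^{ -1}}_i)_{i\in[n]}$ is digraphical, i.e. there is a digraph on vertex set $[n]$ without loops and without multiple parallel arcs in which vertex $i$ has out-degree $d^\tau_i$ and in-degree $d^{\tau^{ -1}}_i$ for all $i$.
   Context: All trees are unlabeled rooted trees; the root is denoted $\bullet$, and for a rooted tree $g$ and integer $k$, $(g)_k$ is the ball of radius $k$ around the root. For a graph $G$ and a vertex $x$, the universal covering tree $T_G$ rooted at $x$ can be described as the tree whose vertices are the non-backtracking walks in $G$ starting at $x$ (rooted at the trivial walk), a walk being adjacent to its one-step extensions; the $h$-depth universal covering neighborhood of $x$ is the ball of radius $h$ around the root in this tree, as an unlabeled rooted tree. The tuple $\mathbf{t}$ is called graphical if there exists a simple graph $G$ on vertex set $[n]=\{1,\dots,n\}$ such that for every $i$, the $h$-depth universal covering neighborhood of $i$ in $G$ is isomorphic (as a rooted tree) to $t_i$. Type of an edge: let $t$ be a rooted tree of depth at most $h$ and $e=(\bullet,x)$ an edge incident to the root. Removing $e$ splits $t$ into two components: $r'$ containing the root, and $s$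 containing $x$, which is rooted at $x$. Deleting from $r'$ all vertices that were at depth exactly $h$ in $t$ (keeping root $\bullet$) gives a rooted tree $r$. The type of $e$ is $\tau(e)=(r,s)$, a pair of unlabeled rooted trees of depth at most $h-1$. For a pair $\tau=(r,s)$ its opposite is $\tau^{ -1}=(s,r)$. Let $\mathrm{types}(\mathbf{t})$ be the set of types of all root-incident edges of all the $t_i$. Let $\Delta$ be the set of types in $\mathrm{types}(\mathbf{t})$ of the form $(r,r)$. Let $A$ be a set of pairs $(r,s)$ with $r\neq s$ such that for every $\tau=(r,s)\in\mathrm{types}(\mathbf{t})$ with $r\ne s$, exactly one of $\tau,\tau^{ -1}$ lies in $A$ (and $A$ contains no other pairs). For any pair $\tau$ and $i\in[n]$, $d^\tau_i$ is the number of edges of $t_i$ incident to the root whose type is $\tau$ (possibly $0$). -}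

module Defs where

open import Data.Nat using (ℕ; zero; suc; _∸_)
open import Data.Bool using (Bool; true; false; _∧_; not)
open import Data.Fin using (Fin; _≟_)
open import Data.Fin.Subset using (Subset; _∈_; ∣_∣)
open import Data.List using (List; []; _∷_; length; lookup; removeAt; map; filterᵇ; allFin)
open import Data.List.Relation.Unary.All using (All)
open import Data.Maybe using (Maybe; just; nothing)
open import Data.Product using (Σ; _×_; ∃)
open import Data.Sum using (_⊎_)
open import Function.Bundles using (_↔_; Inverse)
open import Relation.Nullary using (¬_; does)
open import Relation.Binary.PropositionalEquality using (_≡_)

-- Rooted trees (finite, ordered representation; "unlabeled" = up to ≅)

data Tree : Set where
  node : List Tree → Tree

• : Tree
• = node []

data _≅_ : Tree → Tree → Set where
  iso : ∀ {ts us} (σ : Fin (length ts) ↔ Fin (length us)) →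
        (∀ i → lookup ts i ≅ lookup us (Inverse.to σ i)) →
        node ts ≅ node us

Depth≤ : ℕ → Tree → Set
Depth≤ zero    (node ts) = ts ≡ []
Depth≤ (suc h) (node ts) = All (Depth≤ h) ts

ball : ℕ → Tree → Tree
ball zero    (node ts) = node []
ball (suc k) (node ts) = node (map (ball k) ts)

record SimpleGraph (n : ℕ) : Set where
  field
    adj     : Fin n → Fin n → Bool
    symm    : ∀ i j → adj i j ≡ adj j i
    irrefl  : ∀ i → adj i i ≡ false

degree : ∀ {n} → SimpleGraph n → Fin n → ℕ
degree {n} G i = length (filterᵇ (SimpleGraph.adj G i) (allFin n))

-- digraph without loops; parallel arcs are impossible by construction
record Digraph (n : ℕ) : Set where
  field
    arc      : Fin n → Fin n → Bool
    loopless : ∀ i → arc i i ≡ false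

outdeg : ∀ {n} → Digraph n → Fin n → ℕ
outdeg {n} D i = length (filterᵇ (Digraph.arc D i) (allFin n))

indeg : ∀ {n} → Digraph n → Fin n → ℕ
indeg {n} D i = length (filterᵇ (λ j → Digraph.arc D j i) (allFin n))

GraphicalSeq : ∀ {n} → (Fin n → ℕ) → Set
GraphicalSeq {n} d = Σ (SimpleGraph n) λ G → ∀ i → degree G i ≡ d i

DigraphicalSeq : ∀ {n} → (Fin n → ℕ) → (Fin n → ℕ) → Set
DigraphicalSeq {n} d⁺ d⁻ =
  Σ (Digraph n) λ D → ∀ i → outdeg D i ≡ d⁺ i × indeg D i ≡ d⁻ i

notPrev : ∀ {n} → Maybe (Fin n) → Fin n → Bool
notPrev nothing  y = true
notPrev (just p) y = not (does (p ≟ y))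

-- cover G k prev x : ball of radius k of the tree of non-backtracking
-- walks starting at x, whose previous vertex was prev (if any).
cover : ∀ {n} → SimpleGraph n → ℕ → Maybe (Fin n) → Fin n → Tree
cover G zero    p x = node []
cover {n} G (suc k) p x =
  node (map (cover G k (just x))
            (filterᵇ (λ y → SimpleGraph.adj G x y ∧ notPrev p y) (allFin n)))

ucn : ∀ {n} → SimpleGraph n → ℕ → Fin n → Tree
ucn G h x = cover G h nothing x

Graphical : ∀ {n} → ℕ → (Fin n → Tree) → Set
Graphical {n} h t = Σ (SimpleGraph n) λ G → ∀ i → ucn G h i ≅ t i

children : Tree → List Tree
children (node ts) = ts

Edge : Tree → Set
Edge t = Fin (length (children t))

typeR : ℕ → (t : Tree) → Edge t → Tree
typeR h (node ts) j = ball (h ∸ 1) (node (removeAt ts j))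

typeS : (t : Tree) → Edge t → Tree
typeS (node ts) j = lookup ts j

HasType : ℕ → (t : Tree) → Edge t → Tree → Tree → Set
HasType h t j r s = typeR h t j ≅ r × typeS t j ≅ s

InTypes : ∀ {n} → ℕ → (Fin n → Tree) → Tree → Tree → Set
InTypes h t r s = ∃ λ i → ∃ λ (j : Edge (t i)) → HasType h (t i) j r s

Deg : ℕ → Tree → Tree → Tree → ℕ → Set
Deg h t r s d =
  Σ (Subset (length (children t))) λ S →
    (∀ j → (j ∈ S → HasType h t j r s) × (HasType h t j r s → j ∈ S))
    × ∣ S ∣ ≡ d

-- A valid choice of the set A (as a predicate on pairs, invariant under ≅)
IsOrientation : ∀ {n} → ℕ → (Fin n → Tree) → (Tree → Tree → Set) → Set
IsOrientation h t A =
  (∀ r s r′ s′ → A r s → r ≅ r′ → s ≅ s′ → A r′ s′)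
  × (∀ r s → A r s → ¬ (r ≅ s) × (InTypes h t r s ⊎ InTypes h t s r))
  × (∀ r s → InTypes h t r s → ¬ (r ≅ s) →
       (A r s ⊎ A s r) × ¬ (A r s × A s r))

CondΔ : ∀ {n} → ℕ → (Fin n → Tree) → Set
CondΔ {n} h t =
  ∀ r → InTypes h t r r → (d : Fin n → ℕ) →
    (∀ i → Deg h (t i) r r (d i)) → GraphicalSeq d

CondA : ∀ {n} → ℕ → (Fin n → Tree) → (Tree → Tree → Set) → Set
CondA {n} h t A =
  ∀ r s → A r s → (d⁺ d⁻ : Fin n → ℕ) →
    (∀ i → Deg h (t i) r s (d⁺ i)) → (∀ i → Deg h (t i) s r (d⁻ i)) →
    DigraphicalSeq d⁺ d⁻

-- In a graph G, the root edges of the depth-h universal cover at i are the edges ij of G,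
-- and the type of the edge to j is the pair of covers of i and of j seen across that edge.
-- Hence the edges of a single type form a graph (type (r, r)) or a digraph (type (r, s))
-- with the prescribed degrees.
--
-- Conversely, superimpose one realisation for each class {τ, τ⁻¹} of types. No pair of
-- vertices is joined twice: if t_i has root edges of types a and b and t_j has root edges
-- of types a⁻¹ and b⁻¹, then comparing balls of increasing radius forces a = b. So the
-- edges at i carry exactly the types of t_i, and induction on the radius shows that the
-- cover seen across an edge of type (r, s) is s; hence the depth-h cover at i is t_i.

module Submission where

open import Defs

open import Level using (Level; 0ℓ; _⊔_)
open import Data.Bool using (Bool; true; false; T; _∧_; _∨_; not; if_then_else_)
open import Data.Bool.Properties using (∧-identityʳ; ∨-comm; ∨-zeroʳ; T-≡)
open import Data.Fin as Fin using (Fin; zero; suc)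
open import Data.Fin.Subset using (Subset; ∣_∣) renaming (_∈_ to _∈ₛ_)
open import Data.Fin.Subset.Properties using (⊆-antisym)
open import Data.List using (List; []; _∷_; _++_; concat; length; lookup; map; filterᵇ; tabulate; removeAt; allFin)
open import Data.List.Properties using (map-∘; map-cong; map-cong-local; map-id-local)
open import Data.List.Membership.Propositional using (find) renaming (_∈_ to _∈ₚ_)
open import Data.List.Membership.Propositional.Properties using (∈-allFin; ∈-filter⁺)
open import Data.List.Relation.Binary.Permutation.Homogeneous as Perm using (Permutation)
open import Data.List.Relation.Binary.Pointwise as PW using (Pointwise; []; _∷_)
open import Data.List.Relation.Unary.All as All using (All; []; _∷_)
import Data.List.Relation.Unary.All.Properties as Allₚ
open import Data.List.Relation.Unary.AllPairs using ([]; _∷_)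
open import Data.List.Relation.Unary.Any as Any using (Any; here; there)
import Data.List.Relation.Unary.Any.Properties as Anyₚ
open import Data.List.Relation.Unary.Unique.Propositional using (Unique)
import Data.List.Relation.Unary.Unique.Propositional.Properties as Unique
open import Data.Maybe as Maybe using (Maybe; just; nothing; is-just)
open import Data.Nat using (ℕ; zero; suc; _∸_; _≤_; _<_; _≥_; s≤s; z≤n)
open import Data.Nat.Properties using (0≢1+n; n≤0⇒n≡0; ≮⇒≥; suc-injective; ≤-refl; <⇒≤; +-0-commutativeMonoid)
open import Data.Product as × using (Σ; ∃; ∃₂; _×_; _,_; proj₁; proj₂; map₂′)
import Data.Product.Relation.Binary.Pointwise.NonDependent as ×ᴾ
open import Data.Sum using (_⊎_; inj₁; inj₂)
import Data.Vec as Vec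
open import Data.Vec.Properties using ([]=⇒lookup; lookup⇒[]=; lookup∘tabulate)
open import Function using (_∘_)
open import Function.Bundles using (_↔_; Inverse; _⇔_; Equivalence; mk⇔)
open import Relation.Binary.Bundles using (Setoid; DecSetoid)
open import Relation.Binary.Core using (Rel)
open import Relation.Binary.Definitions using (Decidable; DecidableEquality)
import Relation.Binary.PropositionalEquality as ≡
open import Relation.Binary.PropositionalEquality
  using (_≡_; _≢_; refl; sym; trans; cong; cong₂; subst; module ≡-Reasoning)
import Relation.Binary.Reasoning.Setoid as SetoidReasoning
open import Relation.Nullary using (Dec; yes; no; does; ¬_; contradiction; T?)
import Relation.Nullary.Decidable as Dec
open import Relation.Nullary.Decidable using (dec-true; dec-false; does-⇔; _⊎-dec_)

private
  variable
    a b r : Level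
    A : Set a
    B : Set b

does≡true⇒ : (a? : Dec A) → does a? ≡ true → A
does≡true⇒ (yes a) _ = a

filterᵇ-cong : ∀ {f g : A → Bool} → (∀ x → f x ≡ g x) → ∀ xs → filterᵇ f xs ≡ filterᵇ g xs
filterᵇ-cong f≗g []       = refl
filterᵇ-cong {f = f} {g} f≗g (x ∷ xs) with f x | g x | f≗g x
... | true  | .true  | refl = cong (x ∷_) (filterᵇ-cong f≗g xs)
... | false | .false | refl = filterᵇ-cong f≗g xs

filterᵇ-filterᵇ : ∀ (p q : A → Bool) xs →
                  filterᵇ q (filterᵇ p xs) ≡ filterᵇ (λ x → p x ∧ q x) xs
filterᵇ-filterᵇ p q []       = refl
filterᵇ-filterᵇ p q (x ∷ xs) with p x
... | false = filterᵇ-filterᵇ p q xs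
... | true with q x
...   | true  = cong (x ∷_) (filterᵇ-filterᵇ p q xs)
...   | false = filterᵇ-filterᵇ p q xs

All⇒Pointwise-map : ∀ {R : Rel B r} {f g : A → B} {xs} →
                    All (λ x → R (f x) (g x)) xs → Pointwise R (map f xs) (map g xs)
All⇒Pointwise-map []       = []
All⇒Pointwise-map (r ∷ rs) = r ∷ All⇒Pointwise-map rs

length-filterᵇ-false : (xs : List A) → length (filterᵇ (λ _ → false) xs) ≡ 0
length-filterᵇ-false []       = refl
length-filterᵇ-false (x ∷ xs) = length-filterᵇ-false xs

length-filterᵇ>0 : ∀ {p : A → Bool} {x xs} → x ∈ₚ xs → p x ≡ true → 0 < length (filterᵇ p xs)
length-filterᵇ>0 {xs = y ∷ ys} (here refl) px rewrite px = s≤s z≤n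
length-filterᵇ>0 {p = p} {xs = y ∷ ys} (there x∈) px with p y
... | true  = s≤s z≤n
... | false = length-filterᵇ>0 x∈ px

length-filterᵇ-map : ∀ (p : B → Bool) (f : A → B) xs →
                     length (filterᵇ p (map f xs)) ≡ length (filterᵇ (p ∘ f) xs)
length-filterᵇ-map p f []       = refl
length-filterᵇ-map p f (x ∷ xs) with p (f x)
... | true  = cong suc (length-filterᵇ-map p f xs)
... | false = length-filterᵇ-map p f xs

first : (A → Bool) → (xs : List A) → Maybe (Σ A (_∈ₚ xs))
first p []       = nothing
first p (x ∷ xs) with p x
... | true  = just (x , here refl)
... | false = Maybe.map (×.map₂ there) (first p xs)

first-sound : ∀ (p : A → Bool) xs {x x∈xs} → first p xs ≡ just (x , x∈xs) → p x ≡ true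
first-sound p (y ∷ ys) eq with p y in py
first-sound p (y ∷ ys) refl | true  = py
... | false with first p ys in eq′
first-sound p (y ∷ ys) refl | false | just _ = first-sound p ys eq′

first-complete : ∀ (p : A → Bool) xs {x} → x ∈ₚ xs → p x ≡ true → is-just (first p xs) ≡ true
first-complete p (y ∷ ys) x∈ px with p y in py
... | true = refl
first-complete p (y ∷ ys) (here refl) px | false = contradiction (trans (sym py) px) λ ()
first-complete p (y ∷ ys) (there x∈) px | false with first p ys | first-complete p ys x∈ px
... | just _ | _ = refl

first-none : ∀ {p : A → Bool} → (∀ x → p x ≡ false) → ∀ xs → first p xs ≡ nothing
first-none p≡false []       = refl
first-none {p = p} p≡false (x ∷ xs) rewrite p≡false x | first-none p≡false xs = refl

first-cong : ∀ {p q : A → Bool} → (∀ x → p x ≡ q x) → ∀ xs → first p xs ≡ first q xs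
first-cong p≗q []       = refl
first-cong {p = p} {q} p≗q (x ∷ xs) with p x | q x | p≗q x
... | true  | .true  | refl = refl
... | false | .false | refl = cong (Maybe.map _) (first-cong p≗q xs)

select : List A → List (A × List A)
select []       = []
select (x ∷ xs) = (x , xs) ∷ map (map₂′ (x ∷_)) (select xs)

tabulate-select : ∀ (f : A × List A → B) xs →
                  tabulate (λ j → f (lookup xs j , removeAt xs j)) ≡ map f (select xs)
tabulate-select f []       = refl
tabulate-select f (x ∷ xs) =
  cong (f (x , xs) ∷_) (trans (tabulate-select (f ∘ map₂′ (x ∷_)) xs) (map-∘ (select xs)))

map-proj₁-select : (xs : List A) → map proj₁ (select xs) ≡ xs
map-proj₁-select []       = refl
map-proj₁-select (x ∷ xs) = cong (x ∷_) (trans (sym (map-∘ (select xs))) (map-proj₁-select xs))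

select-map : ∀ (f : A → B) xs →
             select (map f xs) ≡ map (×.map f (map f)) (select xs)
select-map f []       = refl
select-map f (x ∷ xs) = cong ((f x , map f xs) ∷_) (begin
  map (map₂′ (f x ∷_)) (select (map f xs))                ≡⟨ cong (map _) (select-map f xs) ⟩
  map (map₂′ (f x ∷_)) (map (×.map f (map f)) (select xs)) ≡⟨ map-∘ (select xs) ⟨
  map (×.map f (map f) ∘ map₂′ (x ∷_)) (select xs)         ≡⟨ map-∘ (select xs) ⟩
  map (×.map f (map f)) (map (map₂′ (x ∷_)) (select xs))   ∎)
  where open ≡-Reasoning

module SetoidPermutation {a ℓ} (S : Setoid a ℓ) where
  open Setoid S using (_≈_; Carrier) renaming (refl to ≈-refl; sym to ≈-sym)
  open import Data.List.Relation.Binary.Permutation.Setoid S public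
    using (_↭_; ↭-refl; ↭-sym; ↭-trans; ↭-prep; ↭-swap; ↭-reflexive; ↭-reflexive-≋)
  open import Data.List.Relation.Binary.Permutation.Setoid.Properties S public
    using (xs↭ys⇒|xs|≡|ys|; ∈-resp-↭; drop-∷; shift; filter⁺; onIndices-lookup; map⁺)
  open import Data.List.Membership.Setoid S public using (_∈_)
  open import Data.List.Membership.Setoid.Properties using (∈-∃++)

  ∈⇒↭∷ : ∀ {x ys} → x ∈ ys → ∃ λ zs → ys ↭ x ∷ zs
  ∈⇒↭∷ x∈ys with ∈-∃++ S x∈ys
  ... | as , bs , w , x≈w , ys≋ = as ++ bs , ↭-trans (↭-reflexive-≋ ys≋) (shift (≈-sym x≈w) as bs)

  _≈×↭_ : Rel (Carrier × List Carrier) (a ⊔ ℓ)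
  _≈×↭_ = ×ᴾ.Pointwise _≈_ _↭_

  map⁺-≈×↭ : ∀ {_∼_ : Rel B r} {f : Carrier × List Carrier → B} → (∀ {p q} → p ≈×↭ q → f p ∼ f q) →
             ∀ {ps qs} → Permutation _≈×↭_ ps qs → Permutation _∼_ (map f ps) (map f qs)
  map⁺-≈×↭ f-resp (Perm.refl ps≋qs)  = Perm.refl (PW.map⁺ _ _ (PW.map f-resp ps≋qs))
  map⁺-≈×↭ f-resp (Perm.prep e p)    = Perm.prep (f-resp e) (map⁺-≈×↭ f-resp p)
  map⁺-≈×↭ f-resp (Perm.swap e e′ p) = Perm.swap (f-resp e) (f-resp e′) (map⁺-≈×↭ f-resp p)
  map⁺-≈×↭ f-resp (Perm.trans p q)   = Perm.trans (map⁺-≈×↭ f-resp p) (map⁺-≈×↭ f-resp q)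

  select-≋ : ∀ {xs ys} → Pointwise _≈_ xs ys → Pointwise _≈×↭_ (select xs) (select ys)
  select-≋ []            = []
  select-≋ (x≈y ∷ xs≋ys) =
    (x≈y , ↭-reflexive-≋ xs≋ys) ∷ PW.map⁺ _ _ (PW.map (×.map₂ (Perm.prep x≈y)) (select-≋ xs≋ys))

  select-↭ : ∀ {xs ys} → xs ↭ ys → Permutation _≈×↭_ (select xs) (select ys)
  select-↭ (Perm.refl xs≋ys) = Perm.refl (select-≋ xs≋ys)
  select-↭ {x ∷ xs} (Perm.prep x≈y p) =
    Perm.prep (x≈y , p)
      (Perm.trans (map⁺-≈×↭ (×.map₂ (↭-prep x)) (select-↭ p))
                  (Perm.refl (PW.map⁺ _ _ (PW.refl (≈-refl , Perm.prep x≈y ↭-refl)))))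
  select-↭ {x ∷ y ∷ xs} (Perm.swap x≈x′ y≈y′ p) =
    Perm.swap (x≈x′ , Perm.prep y≈y′ p) (y≈y′ , Perm.prep x≈x′ p)
      (Perm.trans (map⁺-≈×↭ (×.map₂ (↭-prep x)) (map⁺-≈×↭ (×.map₂ (↭-prep y)) (select-↭ p)))
                  (Perm.refl (PW.map⁺ _ _ (PW.map⁺ _ _ (PW.refl (≈-refl , Perm.swap x≈x′ y≈y′ ↭-refl))))))
  select-↭ (Perm.trans p q) = Perm.trans (select-↭ p) (select-↭ q)

  Any-select : ∀ {p} {P : Carrier × List Carrier → Set p} xs → Any P (select xs) →
               ∃₂ λ y ys → P (y , ys) × xs ↭ y ∷ ys
  Any-select (x ∷ xs) (here px)  = x , xs , px , ↭-refl
  Any-select (x ∷ xs) (there pe) with Any-select xs (Anyₚ.map⁻ pe)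
  ... | y , ys , py , xs↭y∷ys = y , x ∷ ys , py , ↭-trans (↭-prep x xs↭y∷ys) (↭-swap x y ↭-refl)

  record TwoSelections {p q} (P : Carrier × List Carrier → Set p) (Q : Carrier × List Carrier → Set q)
         : Set (a ⊔ ℓ ⊔ p ⊔ q) where
    field
      {x₁ x₂}       : Carrier
      {r₁ r₂ rest} : List Carrier
      holds₁       : P (x₁ , r₁)
      holds₂       : Q (x₂ , r₂)
      r₁↭x₂∷rest   : r₁ ↭ x₂ ∷ rest
      r₂↭x₁∷rest   : r₂ ↭ x₁ ∷ rest

  Any-select-two : ∀ {p q} {P : Carrier × List Carrier → Set p} {Q : Carrier × List Carrier → Set q} xs →
                   Any P (select xs) → Any Q (select xs) → (∀ {e} → P e → ¬ Q e) → TwoSelections P Q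
  Any-select-two (x ∷ xs) (here px) (here qx) P⇒¬Q = contradiction qx (P⇒¬Q px)
  Any-select-two (x ∷ xs) (here px) (there qe) _ with Any-select xs (Anyₚ.map⁻ qe)
  ... | y , ys , qy , xs↭y∷ys = record
    { holds₁ = px ; holds₂ = qy ; r₁↭x₂∷rest = xs↭y∷ys ; r₂↭x₁∷rest = ↭-refl }
  Any-select-two (x ∷ xs) (there pe) (here qx) _ with Any-select xs (Anyₚ.map⁻ pe)
  ... | y , ys , py , xs↭y∷ys = record
    { holds₁ = py ; holds₂ = qx ; r₁↭x₂∷rest = ↭-refl ; r₂↭x₁∷rest = xs↭y∷ys }
  Any-select-two (x ∷ xs) (there pe) (there qe) P⇒¬Q
    with Any-select-two xs (Anyₚ.map⁻ pe) (Anyₚ.map⁻ qe) P⇒¬Q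
  ... | two = record
    { holds₁ = holds₁ ; holds₂ = holds₂
    ; r₁↭x₂∷rest = ↭-trans (↭-prep x r₁↭x₂∷rest) (↭-swap x _ ↭-refl)
    ; r₂↭x₁∷rest = ↭-trans (↭-prep x r₂↭x₁∷rest) (↭-swap x _ ↭-refl) }
    where open TwoSelections two

module DistinctSelection {a} {A : Set a} (_≟_ : DecidableEquality A) where

  _≢ᵇ_ : A → A → Bool
  x ≢ᵇ y = not (does (x ≟ y))

  ≢ᵇ-refl : ∀ x → x ≢ᵇ x ≡ false
  ≢ᵇ-refl x = cong not (dec-true (x ≟ x) refl)

  ≢⇒≢ᵇ : ∀ {x y} → x ≢ y → x ≢ᵇ y ≡ true
  ≢⇒≢ᵇ {x} {y} x≢y = cong not (dec-false (x ≟ y) x≢y)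

  filterᵇ-≢ᵇ-fresh : ∀ {x xs} → All (x ≢_) xs → filterᵇ (x ≢ᵇ_) xs ≡ xs
  filterᵇ-≢ᵇ-fresh []                      = refl
  filterᵇ-≢ᵇ-fresh {x} (_∷_ {y} x≢y x∉xs) rewrite ≢⇒≢ᵇ x≢y = cong (y ∷_) (filterᵇ-≢ᵇ-fresh x∉xs)

  select-unique : ∀ {xs} → Unique xs → select xs ≡ map (λ y → y , filterᵇ (y ≢ᵇ_) xs) xs
  select-unique {[]}     []              = refl
  select-unique {x ∷ xs} (x∉xs ∷ xs-unique) rewrite ≢ᵇ-refl x = cong₂ _∷_
    (cong (x ,_) (sym (filterᵇ-≢ᵇ-fresh x∉xs)))
    (trans (cong (map _) (select-unique xs-unique))
           (trans (sym (map-∘ xs)) (map-cong-local (All.map tail-step x∉xs))))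
    where
    tail-step : ∀ {y} → x ≢ y → (y , x ∷ filterᵇ (y ≢ᵇ_) xs) ≡ (y , filterᵇ (y ≢ᵇ_) (x ∷ xs))
    tail-step x≢y rewrite ≢⇒≢ᵇ (x≢y ∘ sym) = refl

  module ↭≡ = SetoidPermutation (≡.setoid A)

  ↭-extract : ∀ {x xs} → Unique xs → x ∈ₚ xs → xs ↭≡.↭ x ∷ filterᵇ (x ≢ᵇ_) xs
  ↭-extract {x} {x ∷ xs} (x∉xs ∷ _) (here refl) rewrite ≢ᵇ-refl x =
    ↭≡.↭-prep x (↭≡.↭-reflexive (sym (filterᵇ-≢ᵇ-fresh x∉xs)))
  ↭-extract {x} {y ∷ xs} (y∉xs ∷ xs-unique) (there x∈xs) rewrite ≢⇒≢ᵇ (λ x≡y → All.lookup y∉xs x∈xs (sym x≡y)) =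
    ↭≡.↭-trans (↭≡.↭-prep y (↭-extract xs-unique x∈xs)) (↭≡.↭-swap y x ↭≡.↭-refl)

module Multiplicity {a ℓ} (D : DecSetoid a ℓ) where
  open DecSetoid D public using (_≟_)
  open DecSetoid D using (_≈_; setoid; Carrier)
    renaming (refl to ≈-refl; sym to ≈-sym; trans to ≈-trans)
  open SetoidPermutation setoid public
  open import Algebra.Properties.CommutativeMonoid.Sum +-0-commutativeMonoid using (sum; sum-cong-≗; sum-permute)

  -- Opaque, so that x and y stay inferable from x ≟ᵇ y ≡ b in the lemmas below.
  opaque
    _≟ᵇ_ : Carrier → Carrier → Bool
    x ≟ᵇ y = does (x ≟ y)

    ≟ᵇ⇒≈ : ∀ {x y} → x ≟ᵇ y ≡ true → x ≈ y
    ≟ᵇ⇒≈ {x} {y} = does≡true⇒ (x ≟ y)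

    ≈⇒≟ᵇ : ∀ {x y} → x ≈ y → x ≟ᵇ y ≡ true
    ≈⇒≟ᵇ {x} {y} = dec-true (x ≟ y)

    ≟ᵇ-⇔ : ∀ {x y z w} → (x ≈ y → z ≈ w) → (z ≈ w → x ≈ y) → x ≟ᵇ y ≡ z ≟ᵇ w
    ≟ᵇ-⇔ {x} {y} {z} {w} to from = does-⇔ (mk⇔ to from) (x ≟ y) (z ≟ w)

  ≟ᵇ-respʳ : ∀ {x y z} → y ≈ z → x ≟ᵇ y ≡ x ≟ᵇ z
  ≟ᵇ-respʳ y≈z = ≟ᵇ-⇔ (λ x≈y → ≈-trans x≈y y≈z) (λ x≈z → ≈-trans x≈z (≈-sym y≈z))

  ≟ᵇ-respˡ : ∀ {x y z} → x ≈ y → x ≟ᵇ z ≡ y ≟ᵇ z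
  ≟ᵇ-respˡ x≈y = ≟ᵇ-⇔ (≈-trans (≈-sym x≈y)) (≈-trans x≈y)

  count : Carrier → List Carrier → ℕ
  count c = length ∘ filterᵇ (c ≟ᵇ_)

  count-respˡ : ∀ {c d} xs → c ≈ d → count c xs ≡ count d xs
  count-respˡ xs c≈d = cong length (filterᵇ-cong (λ x → ≟ᵇ-respˡ c≈d) xs)

  count-↭ : ∀ c {xs ys} → xs ↭ ys → count c xs ≡ count c ys
  count-↭ c xs↭ys =
    xs↭ys⇒|xs|≡|ys| (filter⁺ (T? ∘ (c ≟ᵇ_)) (λ y≈z → subst T (≟ᵇ-respʳ y≈z)) xs↭ys)

  count-∷-cancel : ∀ c x xs ys → count c (x ∷ xs) ≡ count c (x ∷ ys) → count c xs ≡ count c ys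
  count-∷-cancel c x xs ys eq with c ≟ᵇ x
  ... | true  = suc-injective eq
  ... | false = eq

  count>0⇒∈ : ∀ c xs → 0 < count c xs → c ∈ xs
  count>0⇒∈ c (x ∷ xs) pos with c ≟ᵇ x in eq
  ... | true  = here (≟ᵇ⇒≈ eq)
  ... | false = there (count>0⇒∈ c xs pos)

  ∈⇒count>0 : ∀ {c xs} → c ∈ xs → 0 < count c xs
  ∈⇒count>0 {c} (here c≈x) rewrite ≈⇒≟ᵇ c≈x = s≤s z≤n
  ∈⇒count>0 {c} {x ∷ xs} (there c∈xs) with c ≟ᵇ x
  ... | true  = s≤s z≤n
  ... | false = ∈⇒count>0 c∈xs

  count≗⇒↭ : ∀ xs ys → (∀ c → count c xs ≡ count c ys) → xs ↭ ys
  count≗⇒↭ []       []       _   = ↭-refl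
  count≗⇒↭ []       (y ∷ ys) eq = contradiction (subst (0 <_) (sym (eq y)) (∈⇒count>0 (here ≈-refl))) λ ()
  count≗⇒↭ (x ∷ xs) ys       eq
    with ∈⇒↭∷ (count>0⇒∈ x ys (subst (0 <_) (eq x) (∈⇒count>0 (here ≈-refl))))
  ... | zs , ys↭x∷zs = ↭-trans (↭-prep x (count≗⇒↭ xs zs eq′)) (↭-sym ys↭x∷zs)
    where
    eq′ : ∀ c → count c xs ≡ count c zs
    eq′ c = count-∷-cancel c x xs zs (trans (eq c) (count-↭ c ys↭x∷zs))

  ∣tabulate∣≡count : ∀ {m} c (f : Fin m → Carrier) → ∣ Vec.tabulate (λ j → c ≟ᵇ f j) ∣ ≡ count c (tabulate f)
  ∣tabulate∣≡count {zero}  c f = refl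
  ∣tabulate∣≡count {suc m} c f with c ≟ᵇ f zero
  ... | true  = cong suc (∣tabulate∣≡count c (f ∘ suc))
  ... | false = ∣tabulate∣≡count c (f ∘ suc)

  indicator : Carrier → Carrier → ℕ
  indicator c x = if c ≟ᵇ x then 1 else 0

  count-as-sum : ∀ c xs → count c xs ≡ sum (λ i → indicator c (lookup xs i))
  count-as-sum c []       = refl
  count-as-sum c (x ∷ xs) with c ≟ᵇ x
  ... | true  = cong suc (count-as-sum c xs)
  ... | false = count-as-sum c xs

  lookup-↔⇒↭ : ∀ xs ys (σ : Fin (length xs) ↔ Fin (length ys)) →
               (∀ i → lookup xs i ≈ lookup ys (Inverse.to σ i)) → xs ↭ ys
  lookup-↔⇒↭ xs ys σ xs≈ys∘σ = count≗⇒↭ xs ys λ c → begin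
    count c xs
      ≡⟨ count-as-sum c xs ⟩
    sum (λ i → indicator c (lookup xs i))
      ≡⟨ sum-cong-≗ (λ i → cong (if_then 1 else 0) (≟ᵇ-respʳ (xs≈ys∘σ i))) ⟩
    sum (λ i → indicator c (lookup ys (Inverse.to σ i)))
      ≡⟨ sum-permute (λ j → indicator c (lookup ys j)) σ ⟨
    sum (λ j → indicator c (lookup ys j))
      ≡⟨ count-as-sum c ys ⟨
    count c ys ∎
    where open ≡-Reasoning

infix 4 _≈_

-- Equivalent to _≅_ (≈⇒≅, ≅⇒≈), but decidable and built from list permutations,
-- which makes multiplicity arguments available.
data _≈_ : Rel Tree 0ℓ where
  node : ∀ {ts us} → Permutation _≈_ ts us → node ts ≈ node us

≈-refl : ∀ {t} → t ≈ t
≈-refl {node ts} = node (Perm.refl (children-refl ts))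
  where
  children-refl : ∀ ts → Pointwise _≈_ ts ts
  children-refl []       = []
  children-refl (t ∷ ts) = ≈-refl ∷ children-refl ts

≈-sym : ∀ {t u} → t ≈ u → u ≈ t
≈-sym (node p) = node (permutation-sym p)
  where
  pointwise-sym : ∀ {ts us} → Pointwise _≈_ ts us → Pointwise _≈_ us ts
  pointwise-sym []       = []
  pointwise-sym (e ∷ es) = ≈-sym e ∷ pointwise-sym es

  permutation-sym : ∀ {ts us} → Permutation _≈_ ts us → Permutation _≈_ us ts
  permutation-sym (Perm.refl es)    = Perm.refl (pointwise-sym es)
  permutation-sym (Perm.prep e p)   = Perm.prep (≈-sym e) (permutation-sym p)
  permutation-sym (Perm.swap e f p) = Perm.swap (≈-sym f) (≈-sym e) (permutation-sym p)
  permutation-sym (Perm.trans p q)  = Perm.trans (permutation-sym q) (permutation-sym p)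

≈-trans : ∀ {t u v} → t ≈ u → u ≈ v → t ≈ v
≈-trans (node p) (node q) = node (Perm.trans p q)

≈-reflexive : ∀ {t u} → t ≡ u → t ≈ u
≈-reflexive refl = ≈-refl

≈-setoid : Setoid 0ℓ 0ℓ
≈-setoid = record
  { Carrier = Tree ; _≈_ = _≈_
  ; isEquivalence = record { refl = ≈-refl ; sym = ≈-sym ; trans = ≈-trans } }

module ↭ₜ = SetoidPermutation ≈-setoid
open ↭ₜ using (_↭_; ↭-refl; ↭-sym; ↭-trans; ↭-prep)

infix 4 _≈?_ _↭?_ _∈?_

mutual
  _≈?_ : Decidable _≈_
  node ts ≈? node us = Dec.map′ node (λ { (node p) → p }) (ts ↭? us)

  _↭?_ : Decidable _↭_
  []       ↭? []       = yes ↭-refl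
  []       ↭? (u ∷ us) = no (λ p → 0≢1+n (↭ₜ.xs↭ys⇒|xs|≡|ys| p))
  (t ∷ ts) ↭? us with t ∈? us
  ... | no t∉us = no (λ p → t∉us (↭ₜ.∈-resp-↭ p (here ≈-refl)))
  ... | yes t∈us with ↭ₜ.∈⇒↭∷ t∈us
  ...   | zs , us↭t∷zs =
    Dec.map′ (λ p → ↭-trans (↭-prep t p) (↭-sym us↭t∷zs)) (λ q → ↭ₜ.drop-∷ (↭-trans q us↭t∷zs)) (ts ↭? zs)

  _∈?_ : ∀ t us → Dec (t ↭ₜ.∈ us)
  t ∈? []       = no (λ ())
  t ∈? (u ∷ us) with t ≈? u
  ... | yes t≈u = yes (here t≈u)
  ... | no t≉u  = Dec.map′ there (λ { (here t≈u) → contradiction t≈u t≉u ; (there t∈us) → t∈us }) (t ∈? us)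

≈-decSetoid : DecSetoid 0ℓ 0ℓ
≈-decSetoid = record { isDecEquivalence = record { isEquivalence = Setoid.isEquivalence ≈-setoid ; _≟_ = _≈?_ } }

mutual
  ≈⇒≅ : ∀ {t u} → t ≈ u → t ≅ u
  ≈⇒≅ {node ts} {node us} (node p) = iso (Perm.onIndices p) (λ i → lookup-≈⇒≅ ts i (↭ₜ.onIndices-lookup p i))

  lookup-≈⇒≅ : ∀ ts i {u} → lookup ts i ≈ u → lookup ts i ≅ u
  lookup-≈⇒≅ (t ∷ ts) zero    t≈u = ≈⇒≅ {t} t≈u
  lookup-≈⇒≅ (t ∷ ts) (suc i) t≈u = lookup-≈⇒≅ ts i t≈u

mutual
  ≅⇒≈ : ∀ {t u} → t ≅ u → t ≈ u
  ≅⇒≈ {node ts} {node us} (iso σ ts≅us∘σ) =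
    node (Multiplicity.lookup-↔⇒↭ ≈-decSetoid ts us σ (λ i → lookup-≅⇒≈ ts i (ts≅us∘σ i)))

  lookup-≅⇒≈ : ∀ ts i {u} → lookup ts i ≅ u → lookup ts i ≈ u
  lookup-≅⇒≈ (t ∷ ts) zero    t≅u = ≅⇒≈ {t} t≅u
  lookup-≅⇒≈ (t ∷ ts) (suc i) t≅u = lookup-≅⇒≈ ts i t≅u

ball-≈ : ∀ k {t u} → t ≈ u → ball k t ≈ ball k u
ball-≈ zero    (node p) = ≈-refl
ball-≈ (suc k) (node p) = node (↭ₜ.map⁺ ≈-setoid (ball-≈ k) p)

ball-zero : ∀ t → ball 0 t ≡ •
ball-zero (node _) = refl

ball-ball : ∀ {j k} → j ≤ k → ∀ t → ball j (ball k t) ≡ ball j t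
ball-ball z≤n       t         = trans (ball-zero _) (sym (ball-zero t))
ball-ball (s≤s j≤k) (node ts) = cong node (trans (sym (map-∘ ts)) (map-cong (ball-ball j≤k) ts))

ball-depth : ∀ k {t} → Depth≤ k t → ball k t ≡ t
ball-depth zero    {node .[]} refl = refl
ball-depth (suc k) {node ts}  ts≤k = cong node (map-id-local (depths ts≤k))
  where
  depths : ∀ {us} → All (Depth≤ k) us → All (λ u → ball k u ≡ u) us
  depths []           = []
  depths (u≤k ∷ us≤k) = ball-depth k u≤k ∷ depths us≤k

ball-≈-ball : ∀ k {t u} → t ≈ ball k u → ball k t ≈ t
ball-≈-ball k {t} {u} t≈u = begin
  ball k t          ≈⟨ ball-≈ k t≈u ⟩
  ball k (ball k u) ≡⟨ ball-ball ≤-refl u ⟩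
  ball k u          ≈⟨ t≈u ⟨
  t                 ∎
  where open SetoidReasoning ≈-setoid

ball-≤-≈ : ∀ {j k} → j ≤ k → ∀ {t u} → t ≈ ball k u → ball j t ≈ ball j u
ball-≤-≈ {j} j≤k {t} {u} t≈u = ≈-trans (ball-≈ j t≈u) (≈-reflexive (ball-ball j≤k u))

ball-suc-↭∷ : ∀ j {r r′ z z′ rest} → r ↭ z ∷ rest → r′ ↭ z′ ∷ rest → ball j z ≈ ball j z′ →
              ball (suc j) (node r) ≈ ball (suc j) (node r′)
ball-suc-↭∷ j r↭ r′↭ z≈z′ =
  ≈-trans (ball-≈ (suc j) (node r↭)) (≈-trans (node (Perm.prep z≈z′ ↭-refl)) (ball-≈ (suc j) (node (↭-sym r′↭))))

Type : Set
Type = Tree × Tree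

_≈ᵀ_ : Rel Type 0ℓ
_≈ᵀ_ = ×ᴾ.Pointwise _≈_ _≈_

≈ᵀ-decSetoid : DecSetoid 0ℓ 0ℓ
≈ᵀ-decSetoid = ×ᴾ.×-decSetoid ≈-decSetoid ≈-decSetoid

module ≈ᵀ = DecSetoid ≈ᵀ-decSetoid
module Types = Multiplicity ≈ᵀ-decSetoid

type : ℕ → Tree × List Tree → Type
type h (x , rest) = ball (h ∸ 1) (node rest) , x

typeOf : ℕ → (t : Tree) → Edge t → Type
typeOf h t j = typeR h t j , typeS t j

types : ℕ → Tree → List Type
types h t = tabulate (typeOf h t)

types-select : ∀ h ts → types h (node ts) ≡ map (type h) (select ts)
types-select h ts = tabulate-select (type h) ts

types-≈ : ∀ h {t u} → t ≈ u → types h t Types.↭ types h u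
types-≈ h {node ts} {node us} (node p) rewrite types-select h ts | types-select h us =
  ↭ₜ.map⁺-≈×↭ (λ (x≈y , r↭r′) → ball-≈ (h ∸ 1) (node r↭r′) , x≈y) (↭ₜ.select-↭ p)

HasType⇔≈ᵀ : ∀ h t j {r s} → HasType h t j r s ⇔ ((r , s) ≈ᵀ typeOf h t j)
HasType⇔≈ᵀ h t j = mk⇔ (λ (r≅ , s≅) → ≈-sym (≅⇒≈ r≅) , ≈-sym (≅⇒≈ s≅))
                 (λ (≈r , ≈s) → ≈⇒≅ (≈-sym ≈r) , ≈⇒≅ (≈-sym ≈s))

typeSubset : ℕ → (t : Tree) → Type → Subset (length (children t))
typeSubset h t c = Vec.tabulate (λ j → c Types.≟ᵇ typeOf h t j)

∈-typeSubset⇔ : ∀ {h t j r s} → j ∈ₛ typeSubset h t (r , s) ⇔ HasType h t j r s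
∈-typeSubset⇔ {h} {t} {j} {r} {s} = mk⇔
  (λ j∈ → from (Types.≟ᵇ⇒≈ (trans (sym (lookup∘tabulate _ j)) ([]=⇒lookup j∈))))
  (λ ht → lookup⇒[]= j _ (trans (lookup∘tabulate _ j) (Types.≈⇒≟ᵇ (to ht))))
  where open Equivalence (HasType⇔≈ᵀ h t j)

Deg-count : ∀ h t r s → Deg h t r s (Types.count (r , s) (types h t))
Deg-count h t r s =
  typeSubset h t (r , s) , (λ j → let open Equivalence (∈-typeSubset⇔ {h} {t} {j}) in to , from)
  , Types.∣tabulate∣≡count (r , s) (typeOf h t)

Deg⇒≡count : ∀ h t r s {d} → Deg h t r s d → d ≡ Types.count (r , s) (types h t)
Deg⇒≡count h t r s (S , S⇔HasType , refl) = trans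
  (cong ∣_∣ (⊆-antisym (λ {j} j∈S → Equivalence.from (∈-typeSubset⇔ {h} {t} {j}) (proj₁ (S⇔HasType j) j∈S))
                       (λ {j} j∈ → proj₂ (S⇔HasType j) (Equivalence.to (∈-typeSubset⇔ {h} {t} {j}) j∈))))
  (Types.∣tabulate∣≡count (r , s) (typeOf h t))

∈-types⇒Any-select : ∀ h {c} ts → c Types.∈ types h (node ts) → Any ((c ≈ᵀ_) ∘ type h) (select ts)
∈-types⇒Any-select h ts c∈ = Anyₚ.map⁻ (subst (Any _) (types-select h ts) c∈)

map-proj₂-types : ∀ h us → map proj₂ (types h (node us)) ≡ us
map-proj₂-types h us = begin
  map proj₂ (types h (node us))        ≡⟨ cong (map proj₂) (types-select h us) ⟩
  map proj₂ (map (type h) (select us)) ≡⟨ map-∘ (select us) ⟨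
  map proj₁ (select us)                ≡⟨ map-proj₁-select us ⟩
  us                                   ∎
  where open ≡-Reasoning

↭types⇒↭children : ∀ h {L us} → L Types.↭ types h (node us) → map proj₂ L ↭ us
↭types⇒↭children h {L} {us} L↭ = subst (map proj₂ L ↭_) (map-proj₂-types h us) (Types.map⁺ ≈-setoid proj₂ L↭)

∷↭types⇒ : ∀ k {X Ms} T → X ∷ Ms Types.↭ types (suc k) T →
           ∃ λ rest → proj₁ X ≈ ball k (node rest) × map proj₂ Ms ↭ rest
∷↭types⇒ k (node us) X∷Ms↭
  with ↭ₜ.Any-select us (∈-types⇒Any-select (suc k) us (Types.∈-resp-↭ X∷Ms↭ (here ≈ᵀ.refl)))
... | x , rest , (X₁≈ , X₂≈x) , us↭x∷rest = rest , X₁≈ , ↭ₜ.drop-∷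
  (↭-trans (Perm.prep (≈-sym X₂≈x) ↭-refl) (↭-trans (↭types⇒↭children (suc k) X∷Ms↭) us↭x∷rest))

↭types⇒≈ : ∀ k {L T} → Depth≤ (suc k) T → L Types.↭ types (suc k) T → node (map (ball k ∘ proj₂) L) ≈ T
↭types⇒≈ k {L} {node us} depth L↭ = begin
  node (map (ball k ∘ proj₂) L)     ≡⟨ cong node (map-∘ L) ⟩
  node (map (ball k) (map proj₂ L)) ≈⟨ node (↭ₜ.map⁺ ≈-setoid (ball-≈ k) (↭types⇒↭children (suc k) L↭)) ⟩
  node (map (ball k) us)            ≡⟨ ball-depth (suc k) depth ⟩
  node us                           ∎
  where open SetoidReasoning ≈-setoid

-- Types in a universal covering tree

≟ᵀ-swap : ∀ c d → c Types.≟ᵇ d ≡ ×.swap c Types.≟ᵇ ×.swap d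
≟ᵀ-swap c d = Types.≟ᵇ-⇔ ×.swap ×.swap

module _ {n} (G : SimpleGraph n) where
  open SimpleGraph G
  open DistinctSelection (Fin._≟_ {n})

  neighbours : Fin n → List (Fin n)
  neighbours x = filterᵇ (adj x) (allFin n)

  neighbours-unique : ∀ x → Unique (neighbours x)
  neighbours-unique x = Unique.filter⁺ (T? ∘ adj x) (Unique.allFin⁺ n)

  neighbours-adj : ∀ x → All (λ y → adj x y ≡ true) (neighbours x)
  neighbours-adj x = All.map (Equivalence.to T-≡) (Allₚ.all-filter (T? ∘ adj x) (allFin n))

  adj⇒∈-neighbours : ∀ {x y} → adj x y ≡ true → y ∈ₚ neighbours x
  adj⇒∈-neighbours {x} {y} adj≡ = ∈-filter⁺ (T? ∘ adj x) (∈-allFin y) (Equivalence.from T-≡ adj≡)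

  edgeType : ℕ → Fin n → Fin n → Type
  edgeType k x y = cover G k (just y) x , cover G k (just x) y

  ball-cover : ∀ k p x → ball k (cover G (suc k) p x) ≡ cover G k p x
  ball-cover zero    p x = ball-zero (cover G 1 p x)
  ball-cover (suc k) p x = cong node (trans (sym (map-∘ _)) (map-cong (ball-cover k (just x)) _))

  ucn-suc : ∀ k x → ucn G (suc k) x ≡ node (map (cover G k (just x)) (neighbours x))
  ucn-suc k x = cong (node ∘ map (cover G k (just x))) (filterᵇ-cong (λ y → ∧-identityʳ (adj x y)) (allFin n))

  neighbours-except : ∀ x y → filterᵇ (y ≢ᵇ_) (neighbours x) ≡ filterᵇ (λ z → adj x z ∧ notPrev (just y) z) (allFin n)
  neighbours-except x y = filterᵇ-filterᵇ (adj x) (y ≢ᵇ_) (allFin n)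

  type-cover : ∀ k x y →
    type (suc k) (cover G k (just x) y , map (cover G k (just x)) (filterᵇ (y ≢ᵇ_) (neighbours x))) ≡ edgeType k x y
  type-cover zero    x y = refl
  type-cover (suc k) x y = cong (_, cover G (suc k) (just x) y) (cong node (begin
    map (ball k) (map (cover G (suc k) (just x)) (filterᵇ (y ≢ᵇ_) (neighbours x)))
      ≡⟨ map-∘ _ ⟨
    map (ball k ∘ cover G (suc k) (just x)) (filterᵇ (y ≢ᵇ_) (neighbours x))
      ≡⟨ map-cong (ball-cover k (just x)) _ ⟩
    map (cover G k (just x)) (filterᵇ (y ≢ᵇ_) (neighbours x))
      ≡⟨ cong (map _) (neighbours-except x y) ⟩
    map (cover G k (just x)) (filterᵇ (λ z → adj x z ∧ notPrev (just y) z) (allFin n)) ∎))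
    where open ≡-Reasoning

  types-ucn : ∀ k x → types (suc k) (ucn G (suc k) x) ≡ map (edgeType k x) (neighbours x)
  types-ucn k x = begin
    types (suc k) (ucn G (suc k) x)
      ≡⟨ cong (types (suc k)) (ucn-suc k x) ⟩
    types (suc k) (node (map cover′ (neighbours x)))
      ≡⟨ types-select (suc k) _ ⟩
    map (type (suc k)) (select (map cover′ (neighbours x)))
      ≡⟨ cong (map _) (select-map cover′ (neighbours x)) ⟩
    map (type (suc k)) (map (×.map cover′ (map cover′)) (select (neighbours x)))
      ≡⟨ map-∘ _ ⟨
    map (type (suc k) ∘ ×.map cover′ (map cover′)) (select (neighbours x))
      ≡⟨ cong (map _) (select-unique (neighbours-unique x)) ⟩
    map (type (suc k) ∘ ×.map cover′ (map cover′)) (map (λ y → y , filterᵇ (y ≢ᵇ_) (neighbours x)) (neighbours x))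
      ≡⟨ map-∘ _ ⟨
    map (λ y → type (suc k) (cover′ y , map cover′ (filterᵇ (y ≢ᵇ_) (neighbours x)))) (neighbours x)
      ≡⟨ map-cong (type-cover k x) _ ⟩
    map (edgeType k x) (neighbours x) ∎
    where
    open ≡-Reasoning

    cover′ : Fin n → Tree
    cover′ = cover G k (just x)

  typed-degree : ∀ k c x {t} → ucn G (suc k) x ≈ t →
    length (filterᵇ (λ y → adj x y ∧ c Types.≟ᵇ edgeType k x y) (allFin n)) ≡ Types.count c (types (suc k) t)
  typed-degree k c x {t} ucn≈t = begin
    length (filterᵇ (λ y → adj x y ∧ c Types.≟ᵇ edgeType k x y) (allFin n))
      ≡⟨ cong length (filterᵇ-filterᵇ (adj x) (λ y → c Types.≟ᵇ edgeType k x y) (allFin n)) ⟨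
    length (filterᵇ ((c Types.≟ᵇ_) ∘ edgeType k x) (neighbours x))
      ≡⟨ length-filterᵇ-map (c Types.≟ᵇ_) (edgeType k x) (neighbours x) ⟨
    Types.count c (map (edgeType k x) (neighbours x))
      ≡⟨ cong (Types.count c) (types-ucn k x) ⟨
    Types.count c (types (suc k) (ucn G (suc k) x))
      ≡⟨ Types.count-↭ c (types-≈ (suc k) ucn≈t) ⟩
    Types.count c (types (suc k) t) ∎
    where open ≡-Reasoning

graphical⇒conditions : ∀ k {n} (t : Fin n → Tree) A → Graphical (suc k) t → CondΔ (suc k) t × CondA (suc k) t A
graphical⇒conditions k {n} t A (G , ucn≅t) = condΔ , condA
  where
  open SimpleGraph G

  typed-degree′ : ∀ c i → length (filterᵇ (λ j → adj i j ∧ c Types.≟ᵇ edgeType G k i j) (allFin n))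
                          ≡ Types.count c (types (suc k) (t i))
  typed-degree′ c i = typed-degree G k c i (≅⇒≈ (ucn≅t i))

  condΔ : CondΔ (suc k) t
  condΔ r _ d r-deg = subgraph , λ i → trans (typed-degree′ (r , r) i) (sym (Deg⇒≡count (suc k) (t i) r r (r-deg i)))
    where
    subgraph : SimpleGraph n
    subgraph = record
      { adj    = λ i j → adj i j ∧ (r , r) Types.≟ᵇ edgeType G k i j
      ; symm   = λ i j → cong₂ _∧_ (symm i j) (≟ᵀ-swap (r , r) (edgeType G k i j))
      ; irrefl = λ i → cong (_∧ (r , r) Types.≟ᵇ edgeType G k i i) (irrefl i) }

  condA : CondA (suc k) t A
  condA r s _ d⁺ d⁻ rs-deg sr-deg = subdigraph , λ i →
      trans (typed-degree′ (r , s) i) (sym (Deg⇒≡count (suc k) (t i) r s (rs-deg i)))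
    , trans (cong length (filterᵇ-cong (λ j → cong₂ _∧_ (symm j i) (≟ᵀ-swap (r , s) (edgeType G k j i))) (allFin n)))
            (trans (typed-degree′ (s , r) i) (sym (Deg⇒≡count (suc k) (t i) s r (sr-deg i))))
    where
    subdigraph : Digraph n
    subdigraph = record
      { arc      = λ i j → adj i j ∧ (r , s) Types.≟ᵇ edgeType G k i j
      ; loopless = λ i → cong (_∧ (r , s) Types.≟ᵇ edgeType G k i i) (irrefl i) }

-- An edge has only one possible type

TwoRootEdges : ℕ → Type → Type → Set
TwoRootEdges k a b = ↭ₜ.TwoSelections ((a ≈ᵀ_) ∘ type (suc k)) ((b ≈ᵀ_) ∘ type (suc k))

-- By induction on j ≤ k, the balls of radius j of A₁ and A₂, and of B₁ and B₂, agree: at the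
-- root of T the edge of type (A₁, B₁) leaves x₂ among the remaining children and the edge
-- of type (A₂, B₂) leaves x₁, where x₁ ≈ B₁ and x₂ ≈ B₂ agree up to radius j - 1; U is symmetric.
opposite-TwoRootEdges⇒≈ᵀ : ∀ k {A₁ B₁ A₂ B₂} →
  TwoRootEdges k (A₁ , B₁) (A₂ , B₂) → TwoRootEdges k (B₁ , A₁) (B₂ , A₂) → (A₁ , B₁) ≈ᵀ (A₂ , B₂)
opposite-TwoRootEdges⇒≈ᵀ k {A₁} {B₁} {A₂} {B₂}
  record { x₁ = x₁ ; x₂ = x₂ ; holds₁ = A₁≈ , B₁≈x₁ ; holds₂ = A₂≈ , B₂≈x₂ ; r₁↭x₂∷rest = r₁↭ ; r₂↭x₁∷rest = r₂↭ }
  record { x₁ = y₁ ; x₂ = y₂ ; holds₁ = B₁≈ , A₁≈y₁ ; holds₂ = B₂≈ , A₂≈y₂ ; r₁↭x₂∷rest = r₁′↭ ; r₂↭x₁∷rest = r₂′↭ } =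
    ≈-trans (≈-sym (ball-≈-ball k A₁≈)) (≈-trans (proj₁ (agree k ≤-refl)) (ball-≈-ball k A₂≈))
  , ≈-trans (≈-sym (ball-≈-ball k B₁≈)) (≈-trans (proj₂ (agree k ≤-refl)) (ball-≈-ball k B₂≈))
  where
  agree : ∀ j → j ≤ k → ball j A₁ ≈ ball j A₂ × ball j B₁ ≈ ball j B₂
  agree zero    _   = ≈-reflexive (trans (ball-zero A₁) (sym (ball-zero A₂)))
                    , ≈-reflexive (trans (ball-zero B₁) (sym (ball-zero B₂)))
  agree (suc j) j<k =
      ≈-trans (ball-≤-≈ j<k A₁≈) (≈-trans (ball-suc-↭∷ j r₁↭ r₂↭ x₂≈x₁) (≈-sym (ball-≤-≈ j<k A₂≈)))
    , ≈-trans (ball-≤-≈ j<k B₁≈) (≈-trans (ball-suc-↭∷ j r₁′↭ r₂′↭ y₂≈y₁) (≈-sym (ball-≤-≈ j<k B₂≈)))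
    where
    IH : ball j A₁ ≈ ball j A₂ × ball j B₁ ≈ ball j B₂
    IH = agree j (<⇒≤ j<k)

    x₂≈x₁ : ball j x₂ ≈ ball j x₁
    x₂≈x₁ = ≈-trans (ball-≈ j (≈-sym B₂≈x₂)) (≈-trans (≈-sym (proj₂ IH)) (ball-≈ j B₁≈x₁))

    y₂≈y₁ : ball j y₂ ≈ ball j y₁
    y₂≈y₁ = ≈-trans (ball-≈ j (≈-sym A₂≈y₂)) (≈-trans (≈-sym (proj₁ IH)) (ball-≈ j A₁≈y₁))

edge-type-unique : ∀ k T U {a b} → a Types.∈ types (suc k) T → b Types.∈ types (suc k) T →
                   ×.swap a Types.∈ types (suc k) U → ×.swap b Types.∈ types (suc k) U → a ≈ᵀ b
edge-type-unique k (node ts) (node us) {a} {b} a∈T b∈T a⁻¹∈U b⁻¹∈U with Types._≟_ a b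
... | yes a≈b = a≈b
... | no  a≉b = opposite-TwoRootEdges⇒≈ᵀ k
  (↭ₜ.Any-select-two ts (∈-types⇒Any-select (suc k) ts a∈T) (∈-types⇒Any-select (suc k) ts b∈T)
                        (λ a≈e b≈e → a≉b (≈ᵀ.trans a≈e (≈ᵀ.sym b≈e))))
  (↭ₜ.Any-select-two us (∈-types⇒Any-select (suc k) us a⁻¹∈U) (∈-types⇒Any-select (suc k) us b⁻¹∈U)
                        (λ a⁻¹≈e b⁻¹≈e → a≉b (×.swap (≈ᵀ.trans a⁻¹≈e (≈ᵀ.sym b⁻¹≈e)))))

-- Superimposing one realisation per class {τ, τ⁻¹} of types

infix 4 _∼ᵀ_

_∼ᵀ_ : Rel Type 0ℓ
c ∼ᵀ d = c ≈ᵀ d ⊎ c ≈ᵀ ×.swap d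

∼ᵀ-sym : ∀ {c d} → c ∼ᵀ d → d ∼ᵀ c
∼ᵀ-sym (inj₁ c≈d)  = inj₁ (≈ᵀ.sym c≈d)
∼ᵀ-sym (inj₂ c≈d⁻¹) = inj₂ (×.swap (≈ᵀ.sym c≈d⁻¹))

∼ᵀ-trans : ∀ {c d e} → c ∼ᵀ d → d ∼ᵀ e → c ∼ᵀ e
∼ᵀ-trans (inj₁ c≈d)   (inj₁ d≈e)   = inj₁ (≈ᵀ.trans c≈d d≈e)
∼ᵀ-trans (inj₁ c≈d)   (inj₂ d≈e⁻¹) = inj₂ (≈ᵀ.trans c≈d d≈e⁻¹)
∼ᵀ-trans (inj₂ c≈d⁻¹) (inj₁ d≈e)   = inj₂ (≈ᵀ.trans c≈d⁻¹ (×.swap d≈e))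
∼ᵀ-trans (inj₂ c≈d⁻¹) (inj₂ d≈e⁻¹) = inj₁ (≈ᵀ.trans c≈d⁻¹ (×.swap d≈e⁻¹))

_∼?_ : Decidable _∼ᵀ_
c ∼? d = Types._≟_ c d ⊎-dec Types._≟_ c (×.swap d)

_∼ᵇ_ : Type → Type → Bool
c ∼ᵇ d = does (c ∼? d)

∼ᵇ⇒∼ᵀ : ∀ {c d} → c ∼ᵇ d ≡ true → c ∼ᵀ d
∼ᵇ⇒∼ᵀ {c} {d} = does≡true⇒ (c ∼? d)

∼ᵀ⇒∼ᵇ : ∀ {c d} → c ∼ᵀ d → c ∼ᵇ d ≡ true
∼ᵀ⇒∼ᵇ {c} {d} = dec-true (c ∼? d)

∼ᵇ-respˡ : ∀ {c c′} → c ∼ᵀ c′ → ∀ d → c ∼ᵇ d ≡ c′ ∼ᵇ d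
∼ᵇ-respˡ {c} {c′} c∼c′ d = does-⇔ (mk⇔ (∼ᵀ-trans (∼ᵀ-sym c∼c′)) (∼ᵀ-trans c∼c′))
  (c ∼? d) (c′ ∼? d)

module Realisation (k : ℕ) {n} (t : Fin n → Tree) (A : Tree → Tree → Set)
                   (orientation : IsOrientation (suc k) t A)
                   (condΔ : CondΔ (suc k) t) (condA : CondA (suc k) t A) where

  typesAt : Fin n → List Type
  typesAt i = types (suc k) (t i)

  mult : Type → Fin n → ℕ
  mult c i = Types.count c (typesAt i)

  allTypes : List Type
  allTypes = concat (map typesAt (allFin n))

  typesAt⊆allTypes : ∀ {c} i → c ∈ₚ typesAt i → c ∈ₚ allTypes
  typesAt⊆allTypes i c∈ = Anyₚ.concat⁺ (Anyₚ.map⁺ (Any.map (λ { refl → c∈ }) (∈-allFin i)))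

  allTypes⇒InTypes : ∀ {r s} → (r , s) ∈ₚ allTypes → InTypes (suc k) t r s
  allTypes⇒InTypes rs∈ with Any.satisfied (Anyₚ.map⁻ (Anyₚ.concat⁻ (map typesAt (allFin n)) rs∈))
  ... | i , rs∈ᵢ with Anyₚ.tabulate⁻ rs∈ᵢ
  ... | j , refl = i , j , Equivalence.from (HasType⇔≈ᵀ (suc k) (t i) j) ≈ᵀ.refl

  record Realised (c : Type) : Set where
    field
      digraph   : Digraph n
      outdeg≡   : ∀ i → outdeg digraph i ≡ mult c i
      indeg≡    : ∀ i → indeg digraph i ≡ mult (×.swap c) i
      symmetric : proj₁ c ≈ proj₂ c → ∀ i j → Digraph.arc digraph i j ≡ Digraph.arc digraph j i
    open Digraph digraph public

  realise : ∀ c → c ∈ₚ allTypes → Realised c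
  realise (r , s) rs∈ with r ≈? s
  ... | yes r≈s = record
    { digraph   = record { arc = adj ; loopless = irrefl }
    ; outdeg≡   = λ i → trans (proj₂ realisation i) (Types.count-respˡ (typesAt i) (≈-refl , r≈s))
    ; indeg≡    = λ i → trans (cong length (filterᵇ-cong (λ j → symm j i) (allFin n)))
                              (trans (proj₂ realisation i) (Types.count-respˡ (typesAt i) (r≈s , ≈-refl)))
    ; symmetric = λ _ → symm }
    where
    rr-inTypes : InTypes (suc k) t r r
    rr-inTypes with allTypes⇒InTypes rs∈
    ... | i , j , r≅ , s≅ = i , j , r≅ , ≈⇒≅ (≈-trans (≅⇒≈ s≅) (≈-sym r≈s))

    realisation : GraphicalSeq (mult (r , r))
    realisation = condΔ r rr-inTypes (mult (r , r)) (λ i → Deg-count (suc k) (t i) r r)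

    open SimpleGraph (proj₁ realisation)
  ... | no r≉s with proj₁ (proj₂ (proj₂ orientation) r s (allTypes⇒InTypes rs∈) (r≉s ∘ ≅⇒≈))
  ...   | inj₁ rs∈A = record
    { digraph   = proj₁ realisation
    ; outdeg≡   = proj₁ ∘ proj₂ realisation
    ; indeg≡    = proj₂ ∘ proj₂ realisation
    ; symmetric = λ r≈s → contradiction r≈s r≉s }
    where
    realisation : DigraphicalSeq (mult (r , s)) (mult (s , r))
    realisation = condA r s rs∈A (mult (r , s)) (mult (s , r))
                        (λ i → Deg-count (suc k) (t i) r s) (λ i → Deg-count (suc k) (t i) s r)
  ...   | inj₂ sr∈A = record
    { digraph   = record { arc = λ i j → arc j i ; loopless = loopless }
    ; outdeg≡   = proj₂ ∘ proj₂ realisation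
    ; indeg≡    = proj₁ ∘ proj₂ realisation
    ; symmetric = λ r≈s → contradiction r≈s r≉s }
    where
    realisation : DigraphicalSeq (mult (s , r)) (mult (r , s))
    realisation = condA s r sr∈A (mult (s , r)) (mult (r , s))
                        (λ i → Deg-count (suc k) (t i) s r) (λ i → Deg-count (suc k) (t i) r s)
    open Digraph (proj₁ realisation)

  Candidate : Set
  Candidate = Σ Type (_∈ₚ allTypes)

  representative : Type → Maybe Candidate
  representative c = first (c ∼ᵇ_) allTypes

  representative-resp : ∀ {c c′} → c ∼ᵀ c′ → representative c ≡ representative c′
  representative-resp c∼c′ = first-cong (∼ᵇ-respˡ c∼c′) allTypes

  representative-∼ᵀ : ∀ {c τ τ∈} → representative c ≡ just (τ , τ∈) → c ∼ᵀ τ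
  representative-∼ᵀ {c} eq = ∼ᵇ⇒∼ᵀ (first-sound (c ∼ᵇ_) allTypes eq)

  representative-complete : ∀ {c} i → c Types.∈ typesAt i → is-just (representative c) ≡ true
  representative-complete {c} i c∈ with find c∈
  ... | τ , τ∈ , c≈τ = first-complete (c ∼ᵇ_) allTypes (typesAt⊆allTypes i τ∈) (∼ᵀ⇒∼ᵇ (inj₁ c≈τ))

  unrepresented⇒mult≡0 : ∀ {c} i → representative c ≡ nothing → mult c i ≡ 0
  unrepresented⇒mult≡0 {c} i eq = n≤0⇒n≡0 (≮⇒≥ λ mult>0 → contradiction
    (trans (sym (cong is-just eq)) (representative-complete i (Types.count>0⇒∈ c (typesAt i) mult>0))) λ ())

  -- Arcs of type c are the arcs of the realisation of the representative τ of its class,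
  -- reversed when c ≈ τ⁻¹.
  arcVia : Type → Maybe Candidate → Fin n → Fin n → Bool
  arcVia c nothing         i j = false
  arcVia c (just (τ , τ∈)) i j = if c Types.≟ᵇ τ then arc i j else arc j i
    where open Realised (realise τ τ∈)

  typedArc : Type → Fin n → Fin n → Bool
  typedArc c = arcVia c (representative c)

  typedArc-loopless : ∀ c i → typedArc c i i ≡ false
  typedArc-loopless c i with representative c
  ... | nothing       = refl
  ... | just (τ , τ∈) with c Types.≟ᵇ τ
  ...   | true  = Realised.loopless (realise τ τ∈) i
  ...   | false = Realised.loopless (realise τ τ∈) i

  typedArc-resp : ∀ {c c′} → c ≈ᵀ c′ → ∀ i j → typedArc c i j ≡ typedArc c′ i j
  typedArc-resp {c} {c′} c≈c′ i j rewrite representative-resp (inj₁ c≈c′) = arcVia-resp (representative c′)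
    where
    arcVia-resp : ∀ m → arcVia c m i j ≡ arcVia c′ m i j
    arcVia-resp nothing       = refl
    arcVia-resp (just (τ , _)) rewrite Types.≟ᵇ-respˡ {z = τ} c≈c′ = refl

  typedArc-swap : ∀ c i j → typedArc (×.swap c) i j ≡ typedArc c j i
  typedArc-swap c i j rewrite representative-resp {×.swap c} {c} (inj₂ ≈ᵀ.refl) = go (representative c) refl
    where
    go : ∀ m → representative c ≡ m → arcVia (×.swap c) m i j ≡ arcVia c m j i
    go nothing        _  = refl
    go (just (τ , τ∈)) eq with ×.swap c Types.≟ᵇ τ in c⁻¹≟τ | c Types.≟ᵇ τ in c≟τ | representative-∼ᵀ eq
    ... | true  | true  | _ = Realised.symmetric (realise τ τ∈)
      (≈-trans (≈-sym (proj₁ (Types.≟ᵇ⇒≈ c⁻¹≟τ))) (proj₂ (Types.≟ᵇ⇒≈ c≟τ))) i j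
    ... | true  | false | _ = refl
    ... | false | true  | _ = refl
    ... | false | false | inj₁ c≈τ   = contradiction (trans (sym c≟τ) (Types.≈⇒≟ᵇ c≈τ)) λ ()
    ... | false | false | inj₂ c≈τ⁻¹ = contradiction (trans (sym c⁻¹≟τ) (Types.≈⇒≟ᵇ (×.swap c≈τ⁻¹))) λ ()

  typedArc-outdeg : ∀ c i → length (filterᵇ (typedArc c i) (allFin n)) ≡ mult c i
  typedArc-outdeg c i = go (representative c) refl
    where
    go : ∀ m → representative c ≡ m → length (filterᵇ (arcVia c m i) (allFin n)) ≡ mult c i
    go nothing         eq = trans (length-filterᵇ-false (allFin n)) (sym (unrepresented⇒mult≡0 i eq))
    go (just (τ , τ∈)) eq with c Types.≟ᵇ τ in c≟τ | representative-∼ᵀ eq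
    ... | true  | _          = trans (Realised.outdeg≡ (realise τ τ∈) i)
                                     (sym (Types.count-respˡ (typesAt i) (Types.≟ᵇ⇒≈ c≟τ)))
    ... | false | inj₁ c≈τ   = contradiction (trans (sym c≟τ) (Types.≈⇒≟ᵇ c≈τ)) λ ()
    ... | false | inj₂ c≈τ⁻¹ = trans (Realised.indeg≡ (realise τ τ∈) i) (sym (Types.count-respˡ (typesAt i) c≈τ⁻¹))

  typedArc⇒∈ : ∀ c i j → typedArc c i j ≡ true → c Types.∈ typesAt i
  typedArc⇒∈ c i j arc = Types.count>0⇒∈ c (typesAt i)
    (subst (0 <_) (typedArc-outdeg c i) (length-filterᵇ>0 (∈-allFin j) arc))

  typedArc-unique : ∀ {c c′} i j → typedArc c i j ≡ true → typedArc c′ i j ≡ true → c ≈ᵀ c′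
  typedArc-unique {c} {c′} i j arc arc′ = edge-type-unique k (t i) (t j)
    (typedArc⇒∈ c i j arc) (typedArc⇒∈ c′ i j arc′)
    (typedArc⇒∈ (×.swap c) j i (trans (typedArc-swap c j i) arc))
    (typedArc⇒∈ (×.swap c′) j i (trans (typedArc-swap c′ j i) arc′))

  joins : Fin n → Fin n → Type → Bool
  joins i j τ = typedArc τ i j ∨ typedArc τ j i

  firstJoining : Fin n → Fin n → Maybe Candidate
  firstJoining i j = first (joins i j) allTypes

  graph : SimpleGraph n
  graph = record
    { adj    = λ i j → is-just (firstJoining i j)
    ; symm   = λ i j → cong is-just (first-cong (λ τ → ∨-comm (typedArc τ i j) (typedArc τ j i)) allTypes)
    ; irrefl = λ i → cong is-just
                 (first-none (λ τ → cong₂ _∨_ (typedArc-loopless τ i) (typedArc-loopless τ i)) allTypes) }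

  open SimpleGraph graph using (adj; symm)

  orientedType : Fin n → Fin n → Maybe Candidate → Type
  orientedType i j nothing       = • , •  -- junk value, never the type of an edge
  orientedType i j (just (τ , _)) = if typedArc τ i j then τ else ×.swap τ

  typeOfEdge : Fin n → Fin n → Type
  typeOfEdge i j = orientedType i j (firstJoining i j)

  typedArc-typeOfEdge : ∀ i j → adj i j ≡ true → typedArc (typeOfEdge i j) i j ≡ true
  typedArc-typeOfEdge i j adj≡true with firstJoining i j in eq
  ... | just (τ , _) with typedArc τ i j in arc
  ...   | true  = arc
  ...   | false = trans (typedArc-swap τ i j)
                        (trans (sym (cong (_∨ typedArc τ j i) arc)) (first-sound (joins i j) allTypes eq))

  typedArc⇒adj : ∀ c i j → typedArc c i j ≡ true → adj i j ≡ true
  typedArc⇒adj c i j arc = go (representative c) refl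
    where
    go : ∀ m → representative c ≡ m → adj i j ≡ true
    go nothing         eq = contradiction (trans (sym arc) (cong (λ m → arcVia c m i j) eq)) λ ()
    go (just (τ , τ∈)) eq with representative-∼ᵀ eq
    ... | inj₁ c≈τ   = first-complete (joins i j) allTypes τ∈
                         (cong (_∨ typedArc τ j i) (trans (sym (typedArc-resp c≈τ i j)) arc))
    ... | inj₂ c≈τ⁻¹ = first-complete (joins i j) allTypes τ∈
                         (trans (cong (typedArc τ i j ∨_) τ-arc) (∨-zeroʳ (typedArc τ i j)))
      where
      τ-arc : typedArc τ j i ≡ true
      τ-arc = trans (sym (typedArc-swap τ i j)) (trans (sym (typedArc-resp c≈τ⁻¹ i j)) arc)

  adj∧≟ᵇ≡typedArc : ∀ c i j → (adj i j ∧ c Types.≟ᵇ typeOfEdge i j) ≡ typedArc c i j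
  adj∧≟ᵇ≡typedArc c i j with adj i j in adj≡ | typedArc c i j in arc
  ... | false | false = refl
  ... | false | true  = contradiction (trans (sym adj≡) (typedArc⇒adj c i j arc)) λ ()
  ... | true  | true  = Types.≈⇒≟ᵇ (typedArc-unique i j arc (typedArc-typeOfEdge i j adj≡))
  ... | true  | false with c Types.≟ᵇ typeOfEdge i j in c≟
  ...   | false = refl
  ...   | true  = contradiction
    (trans (sym arc) (trans (typedArc-resp (Types.≟ᵇ⇒≈ c≟) i j) (typedArc-typeOfEdge i j adj≡))) λ ()

  typeOfEdge-swap : ∀ i j → adj i j ≡ true → typeOfEdge j i ≈ᵀ ×.swap (typeOfEdge i j)
  typeOfEdge-swap i j adj≡ = typedArc-unique j i
    (typedArc-typeOfEdge j i (trans (symm j i) adj≡))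
    (trans (typedArc-swap (typeOfEdge i j) j i) (typedArc-typeOfEdge i j adj≡))

  edgeTypes↭typesAt : ∀ i → map (typeOfEdge i) (neighbours graph i) Types.↭ typesAt i
  edgeTypes↭typesAt i = Types.count≗⇒↭ _ _ λ c → begin
    Types.count c (map (typeOfEdge i) (neighbours graph i))
      ≡⟨ length-filterᵇ-map (c Types.≟ᵇ_) (typeOfEdge i) (neighbours graph i) ⟩
    length (filterᵇ ((c Types.≟ᵇ_) ∘ typeOfEdge i) (neighbours graph i))
      ≡⟨ cong length (filterᵇ-filterᵇ (adj i) (λ j → c Types.≟ᵇ typeOfEdge i j) (allFin n)) ⟩
    length (filterᵇ (λ j → adj i j ∧ c Types.≟ᵇ typeOfEdge i j) (allFin n))
      ≡⟨ cong length (filterᵇ-cong (adj∧≟ᵇ≡typedArc c i) (allFin n)) ⟩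
    length (filterᵇ (typedArc c i) (allFin n))
      ≡⟨ typedArc-outdeg c i ⟩
    mult c i ∎
    where open ≡-Reasoning

  open DistinctSelection (Fin._≟_ {n}) using (_≢ᵇ_; module ↭≡; ↭-extract)

  edgeTypes-except↭typesAt : ∀ i j → adj i j ≡ true →
    typeOfEdge j i ∷ map (typeOfEdge j) (filterᵇ (i ≢ᵇ_) (neighbours graph j)) Types.↭ typesAt j
  edgeTypes-except↭typesAt i j adj≡ = Types.↭-trans
    (↭≡.map⁺ ≈ᵀ.setoid (λ { refl → ≈ᵀ.refl })
      (↭≡.↭-sym (↭-extract (neighbours-unique graph j) (adj⇒∈-neighbours graph (trans (symm j i) adj≡)))))
    (edgeTypes↭typesAt j)

  cover-≈-ball : ∀ m → m ≤ k → ∀ i j → adj i j ≡ true → cover graph m (just i) j ≈ ball m (proj₂ (typeOfEdge i j))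
  cover-≈-ball zero    _   i j _    = ≈-reflexive (sym (ball-zero _))
  cover-≈-ball (suc m) m<k i j adj≡ with ∷↭types⇒ k (t j) (edgeTypes-except↭typesAt i j adj≡)
  ... | rest , ji₁≈ , others↭rest = begin
    cover graph (suc m) (just i) j
      ≡⟨ cong (node ∘ map (cover graph m (just j))) (neighbours-except graph j i) ⟨
    node (map (cover graph m (just j)) others)
      ≈⟨ node (Perm.refl (All⇒Pointwise-map (All.map (λ {y} → cover-≈-ball m (<⇒≤ m<k) j y) others-adj))) ⟩
    node (map (ball m ∘ proj₂ ∘ typeOfEdge j) others)
      ≡⟨ cong node (trans (map-∘ others) (map-∘ _)) ⟩
    node (map (ball m) (map proj₂ (map (typeOfEdge j) others)))
      ≈⟨ node (↭ₜ.map⁺ ≈-setoid (ball-≈ m) others↭rest) ⟩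
    ball (suc m) (node rest)
      ≈⟨ ball-≤-≈ m<k ji₁≈ ⟨
    ball (suc m) (proj₁ (typeOfEdge j i))
      ≈⟨ ball-≈ (suc m) (proj₁ (typeOfEdge-swap i j adj≡)) ⟩
    ball (suc m) (proj₂ (typeOfEdge i j)) ∎
    where
    open SetoidReasoning ≈-setoid

    others : List (Fin n)
    others = filterᵇ (i ≢ᵇ_) (neighbours graph j)

    others-adj : All (λ y → adj j y ≡ true) others
    others-adj = Allₚ.filter⁺ (T? ∘ (i ≢ᵇ_)) (neighbours-adj graph j)

  graphical : (∀ i → Depth≤ (suc k) (t i)) → Graphical (suc k) t
  graphical depth = graph , λ i → ≈⇒≅ (begin
    ucn graph (suc k) i
      ≡⟨ ucn-suc graph k i ⟩
    node (map (cover graph k (just i)) (neighbours graph i))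
      ≈⟨ node (Perm.refl (All⇒Pointwise-map (All.map (λ {j} → cover-≈-ball k ≤-refl i j) (neighbours-adj graph i)))) ⟩
    node (map (ball k ∘ proj₂ ∘ typeOfEdge i) (neighbours graph i))
      ≡⟨ cong node (map-∘ _) ⟩
    node (map (ball k ∘ proj₂) (map (typeOfEdge i) (neighbours graph i)))
      ≈⟨ ↭types⇒≈ k (depth i) (edgeTypes↭typesAt i) ⟩
    t i ∎)
    where open SetoidReasoning ≈-setoid

theorem1p3 : (h n : ℕ) → h ≥ 1 → n ≥ 1 → (t : Fin n → Tree) →
    (∀ i → Depth≤ h (t i)) →
    (A : Tree → Tree → Set) → IsOrientation h t A →
    Graphical h t ⇔ (CondΔ h t × CondA h t A)
theorem1p3 (suc k) n (s≤s z≤n) _ t depth A orientation = mk⇔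
  (graphical⇒conditions k t A)
  (λ (condΔ , condA) → Realisation.graphical k t A orientation condΔ condA depth)
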